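{- Let $N,n\in\mathbb{N}$ with $N\log n\ge e^{2000}$ (where $\log$ is to base $2$). Let $\mathcal{F}$ be a graph class and let $G,H$ be graphs on at most $n$ vertices. If $G\not\equiv_{\mathcal{F}_{\le N}}H$, then there exists a prime $p$ with $N\log n<p\le(N\log n)^2$ such that $G\not\equiv^p_{\mathcal{F}_{\le N}}H$.
   Context: $\hom(F,G)$ is the number of homomorphisms $F\to G$. $G\equiv_{\mathcal{F}}H$ means $\hom(F,G)=\hom(F,H)$ for all $F\in\mathcal{F}$; $G\equiv^p_{\mathcal{F}}H$ means $\hom(F,G)\equiv\hom(F,H)\pmod p$ for all $F\in\mathcal{F}$. $\mathcal{F}_{\le N}:=\{F\in\mathcal{F}:|V(F)|\le N\}$. -}

module Defs where

open import Data.Nat using (ℕ; zero; suc; _+_; _*_; _^_; _≤_; _<_)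
open import Data.Nat using (_!)
open import Data.Nat.ListAction using (sum)
open import Data.Fin using (Fin)
open import Data.Bool using (Bool; true; false; _∧_; _∨_; not; if_then_else_)
open import Data.List using (List; []; _∷_; map; concatMap; allFin)
open import Data.Bool.ListAction using (and)
open import Data.Vec using (Vec; []; _∷_; lookup)
open import Data.Integer using (ℤ; +_; _-_)
open import Data.Integer.Divisibility using (_∣_)
open import Relation.Binary.PropositionalEquality using (_≡_)
open import Relation.Nullary using (¬_)
open import Data.Product using (Σ; _×_)

record Graph : Set where
  field
    V     : ℕ
    adj   : Fin V → Fin V → Bool
    sym   : ∀ u v → adj u v ≡ adj v u
    irref : ∀ u → adj u u ≡ false
open Graph public

GraphClass : Set₁
GraphClass = Graph → Set

allMaps : (k m : ℕ) → List (Vec (Fin m) k)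
allMaps zero    m = [] ∷ []
allMaps (suc k) m = concatMap (λ i → map (i ∷_) (allMaps k m)) (allFin m)

isHom : (F G : Graph) → Vec (Fin (V G)) (V F) → Bool
isHom F G f =
  and (map (λ u → and (map (λ v → not (adj F u v) ∨ adj G (lookup f u) (lookup f v)) (allFin (V F)))) (allFin (V F)))

hom : Graph → Graph → ℕ
hom F G = sum (map (λ f → if isHom F G f then 1 else 0) (allMaps (V F) (V G)))

_≡_[mod_] : ℕ → ℕ → ℕ → Set
a ≡ b [mod p ] = (+ p) ∣ ((+ a) - (+ b))

NotEquivLe : GraphClass → ℕ → Graph → Graph → Set
NotEquivLe 𝓕 N G H = Σ Graph λ F → 𝓕 F × V F ≤ N × ¬ (hom F G ≡ hom F H)

NotEquivModLe : ℕ → GraphClass → ℕ → Graph → Graph → Set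
NotEquivModLe p 𝓕 N G H = Σ Graph λ F → 𝓕 F × V F ≤ N × ¬ (hom F G ≡ hom F H [mod p ])

-- Real-number comparisons with x = N · log₂ n, encoded exactly in ℕ.
-- For a,b ∈ ℕ, b > 0 :   a/b ≤ N log₂ n  ⇔  2^a ≤ n^(N·b).

RatLeNLog : (a b N n : ℕ) → Set
RatLeNLog a b N n = 2 ^ a ≤ n ^ (N * b)

-- A m = Σ_{k ≤ m} m!/k!, so A m / m! = Σ_{k ≤ m} 1/k! is the m-th partial sum of e.
eNum : ℕ → ℕ
eNum zero    = 1
eNum (suc m) = suc m * eNum m + 1

-- e^2000 ≤ N log₂ n : e^2000 is the supremum of the strictly increasing
-- rationals (A m / m!)^2000, so this holds iff each of them is ≤ N log₂ n.
ExpBoundLe : (N n : ℕ) → Set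
ExpBoundLe N n = ∀ m → RatLeNLog (eNum m ^ 2000) ((m !) ^ 2000) N n

-- N log₂ n < p   ⇔   n^N < 2^p.
NLogLt : (N n p : ℕ) → Set
NLogLt N n p = n ^ N < 2 ^ p

-- p ≤ (N log₂ n)^2  ⇔  √p ≤ N log₂ n  ⇔  every rational a/b (b>0) with
-- (a/b)^2 ≤ p satisfies a/b ≤ N log₂ n.
SqLe : (p N n : ℕ) → Set
SqLe p N n = ∀ a b → a * a ≤ p * (suc b * suc b) → RatLeNLog a (suc b) N n

module Submission where

-- Pick F ∈ 𝓕 with |V(F)| ≤ N and hom(F,G) ≠ hom(F,H), and put d = |hom(F,G) - hom(F,H)|
-- and L = ⌊N log₂ n⌋, so that 0 < d ≤ n^N < 2^(L+1). Any prime p ∈ (L, L²] not dividing d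
-- does the job. Such a prime exists by an Erdős-style Chebyshev estimate: if every prime in
-- (L, 2M] divided d, where 2M = 2^E ≤ L², then comparing prime-power exponents through
-- Legendre's formula gives (2M)! ∣ (M!)² (L!)^E d, so 2^M ≤ (2M)!/(M!)² ≤ (L!)^E d < 2^(O(L log² L)),
-- which is false for M = 2^(2⌊log₂ L⌋-1) ≥ L²/8 as soon as L ≥ 2^10.

open import Data.Bool.Base using (Bool; true; false; if_then_else_)
import Data.Integer.Base as ℤ
import Data.Integer.Properties as ℤ
open import Data.List.Base using (List; []; _∷_; _++_; length; map; concatMap; allFin)
open import Data.List.Properties using (length-++; length-map; length-tabulate)
open import Data.List.Relation.Unary.All using (All; []; _∷_)
open import Data.Nat
open import Data.Nat.Divisibility
open import Data.Nat.ListAction using (sum; product)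
open import Data.Nat.Primality
  using (Prime; prime⇒nonZero; prime⇒nonTrivial; prime⇒irreducible; ¬prime[1]; euclidsLemma; prime?)
open import Data.Nat.Primality.Factorisation using (factorise; PrimeFactorisation)
open import Data.Nat.Properties
open import Data.Nat.Tactic.RingSolver using (solve-∀)
open import Data.Product using (Σ; _×_; _,_; proj₁; proj₂; ∃-syntax)
open import Data.Sum using (inj₁; inj₂; [_,_])
open import Data.Vec.Base using (_∷_)
open import Function using (id; _∘_)
open import Relation.Binary.PropositionalEquality
  using (_≡_; refl; sym; trans; cong; cong₂; subst; module ≡-Reasoning)
open import Relation.Nullary using (¬_; Dec; yes; no; ¬?; _×-dec_; contradiction)
open import Relation.Nullary.Decidable using (decidable-stable; toWitness)
open import Relation.Unary using (Decidable)

open import Defs hiding (sym)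

∃-boundary : ∀ {P : ℕ → Set} → Decidable P → ∀ m → P 0 → ¬ P m → ∃[ k ] P k × ¬ P (suc k)
∃-boundary P? zero    P0 ¬P0 = contradiction P0 ¬P0
∃-boundary P? (suc m) P0 ¬P[1+m] with P? m
... | yes Pm = m , Pm , ¬P[1+m]
... | no ¬Pm = ∃-boundary P? m P0 ¬Pm

n<m^n : ∀ {m} → 1 < m → ∀ n → n < m ^ n
n<m^n 1<m zero = s≤s z≤n
n<m^n {m} 1<m (suc n) = begin-strict
  suc n           ≤⟨ n<m^n 1<m n ⟩
  m ^ n           <⟨ m<m*n (m ^ n) m {{m^n≢0 m n {{>-nonZero (<-trans z<s 1<m)}}}} 1<m ⟩
  m ^ n * m       ≡⟨ *-comm (m ^ n) m ⟩
  m * m ^ n       ∎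
  where open ≤-Reasoning

∃-⌊log⌋ : ∀ {b} → 1 < b → ∀ x → 1 ≤ x → ∃[ k ] b ^ k ≤ x × x < b ^ suc k
∃-⌊log⌋ {b} 1<b x 1≤x with ∃-boundary (λ k → b ^ k ≤? x) x 1≤x (<⇒≱ (n<m^n 1<b x))
... | k , b^k≤x , b^[1+k]≰x = k , b^k≤x , ≰⇒> b^[1+k]≰x

^-cancelʳ-≤ : ∀ {m a b} → 1 < m → m ^ a ≤ m ^ b → a ≤ b
^-cancelʳ-≤ {m} {a} {b} 1<m m^a≤m^b with a ≤? b
... | yes a≤b = a≤b
... | no a≰b = contradiction m^a≤m^b (<⇒≱ (^-monoʳ-< m 1<m (≰⇒> a≰b)))

^-cancelʳ-< : ∀ {m a b} → 1 < m → m ^ a < m ^ b → a < b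
^-cancelʳ-< {m} {a} {b} 1<m m^a<m^b with a <? b
... | yes a<b = a<b
... | no a≮b = contradiction (^-monoʳ-≤ m {{>-nonZero (<-trans z<s 1<m)}} (≮⇒≥ a≮b)) (<⇒≱ m^a<m^b)

indicator : ∀ {A : Set} → Dec A → ℕ
indicator (yes _) = 1
indicator (no _)  = 0

-- f 1 + ⋯ + f K: the index 0 is not summed.
sumTo : ℕ → (ℕ → ℕ) → ℕ
sumTo zero    f = 0
sumTo (suc K) f = f (suc K) + sumTo K f

sumTo-distrib-+ : ∀ K f g → sumTo K (λ i → f i + g i) ≡ sumTo K f + sumTo K g
sumTo-distrib-+ zero    f g = refl
sumTo-distrib-+ (suc K) f g rewrite sumTo-distrib-+ K f g =
  +-+-comm (f (suc K)) (g (suc K)) (sumTo K f) (sumTo K g)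
  where
  +-+-comm : ∀ a b c d → (a + b) + (c + d) ≡ (a + c) + (b + d)
  +-+-comm = solve-∀

sumTo-mono-≤ : ∀ K {f g} → (∀ i → f i ≤ g i) → sumTo K f ≤ sumTo K g
sumTo-mono-≤ zero    f≤g = z≤n
sumTo-mono-≤ (suc K) f≤g = +-mono-≤ (f≤g (suc K)) (sumTo-mono-≤ K f≤g)

sumTo-const : ∀ K c → sumTo K (λ _ → c) ≡ K * c
sumTo-const zero    c = refl
sumTo-const (suc K) c = cong (c +_) (sumTo-const K c)

sumTo-threshold : ∀ K v {f} → (∀ i → i ≤ v → f i ≡ 1) → (∀ i → v < i → f i ≡ 0) →
                  sumTo K f ≡ K ⊓ v
sumTo-threshold zero    v f≡1 f≡0 = refl
sumTo-threshold (suc K) v {f} f≡1 f≡0 with suc K ≤? v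
... | yes 1+K≤v = begin
  f (suc K) + sumTo K _  ≡⟨ cong₂ _+_ (f≡1 (suc K) 1+K≤v) (sumTo-threshold K v f≡1 f≡0) ⟩
  suc (K ⊓ v)            ≡⟨ cong suc (m≤n⇒m⊓n≡m (≤-trans (n≤1+n K) 1+K≤v)) ⟩
  suc K                  ≡⟨ m≤n⇒m⊓n≡m 1+K≤v ⟨
  suc K ⊓ v              ∎
  where open ≡-Reasoning
... | no 1+K≰v = begin
  f (suc K) + sumTo K _  ≡⟨ cong₂ _+_ (f≡0 (suc K) v<1+K) (sumTo-threshold K v f≡1 f≡0) ⟩
  K ⊓ v                  ≡⟨ m≥n⇒m⊓n≡n (≤-pred v<1+K) ⟩
  v                      ≡⟨ m≥n⇒m⊓n≡n (<⇒≤ v<1+K) ⟨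
  suc K ⊓ v              ∎
  where
  open ≡-Reasoning
  v<1+K = ≰⇒> 1+K≰v

multiples : ℕ → ℕ → ℕ
multiples q zero    = 0
multiples q (suc n) = indicator (q ∣? suc n) + multiples q n

multiples-bounds : ∀ q .{{_ : NonZero q}} n →
                   multiples q n * q ≤ n × n < suc (multiples q n) * q
multiples-bounds q zero = z≤n , >-nonZero⁻¹ (1 * q) {{m*n≢0 1 q}}
multiples-bounds q (suc n) with q ∣? suc n | multiples-bounds q n
... | no q∤1+n | lo , hi = m≤n⇒m≤1+n lo , ≤∧≢⇒< hi (q∤1+n ∘ divides (suc (multiples q n)))
... | yes (divides t 1+n≡tq) | lo , hi = ≤-reflexive (sym 1+n≡[1+c]q) , 1+n<[2+c]q
  where
  c = multiples q n
  t≡1+c : t ≡ suc c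
  t≡1+c = ≤-antisym (*-cancelʳ-≤ t (suc c) q (subst (_≤ suc c * q) 1+n≡tq hi))
                    (*-cancelʳ-< q c t (subst (c * q <_) 1+n≡tq (s≤s lo)))
  1+n≡[1+c]q : suc n ≡ suc c * q
  1+n≡[1+c]q = trans 1+n≡tq (cong (_* q) t≡1+c)
  1+n<[2+c]q : suc n < suc (suc c) * q
  1+n<[2+c]q = begin-strict
    suc n          ≡⟨ 1+n≡[1+c]q ⟩
    suc c * q      <⟨ m<m+n (suc c * q) (>-nonZero⁻¹ q) ⟩
    suc c * q + q  ≡⟨ +-comm (suc c * q) q ⟩
    suc (suc c) * q ∎
    where open ≤-Reasoning

multiples-+ : ∀ q .{{_ : NonZero q}} m n →
              multiples q (m + n) ≤ multiples q m + multiples q n + 1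
multiples-+ q m n = subst (multiples q (m + n) ≤_) (+-comm 1 (a + b)) (≤-pred c<2+a+b)
  where
  a = multiples q m
  b = multiples q n
  c<2+a+b : multiples q (m + n) < suc (suc (a + b))
  c<2+a+b = *-cancelʳ-< q _ _ (begin-strict
    multiples q (m + n) * q  ≤⟨ proj₁ (multiples-bounds q (m + n)) ⟩
    m + n                    <⟨ +-mono-< (proj₂ (multiples-bounds q m)) (proj₂ (multiples-bounds q n)) ⟩
    suc a * q + suc b * q    ≡⟨ distrib a b q ⟩
    suc (suc (a + b)) * q    ∎)
    where
    open ≤-Reasoning
    distrib : ∀ a b q → suc a * q + suc b * q ≡ suc (suc (a + b)) * q
    distrib = solve-∀

^-monoʳ-∣ : ∀ m {i j} → i ≤ j → m ^ i ∣ m ^ j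
^-monoʳ-∣ m {i} {j} i≤j = subst (m ^ i ∣_) m^i*m^[j∸i]≡m^j (m∣m*n (m ^ (j ∸ i)))
  where
  m^i*m^[j∸i]≡m^j : m ^ i * m ^ (j ∸ i) ≡ m ^ j
  m^i*m^[j∸i]≡m^j = trans (sym (^-distribˡ-+-* m i (j ∸ i))) (cong (m ^_) (m+[n∸m]≡n i≤j))

^-monoˡ-∣ : ∀ {a b} e → a ∣ b → a ^ e ∣ b ^ e
^-monoˡ-∣ zero    a∣b = ∣-refl
^-monoˡ-∣ (suc e) a∣b = *-pres-∣ a∣b (^-monoˡ-∣ e a∣b)

n∣n! : ∀ n .{{_ : NonZero n}} → n ∣ n !
n∣n! (suc n) = m∣m*n (n !)

prime∣prime⇒≡ : ∀ {q p} → Prime q → Prime p → q ∣ p → q ≡ p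
prime∣prime⇒≡ q-prime p-prime q∣p with prime⇒irreducible p-prime q∣p
... | inj₁ refl = contradiction q-prime ¬prime[1]
... | inj₂ q≡p  = q≡p

prime^∣*-cancelˡ : ∀ {q m} → Prime q → ¬ q ∣ m → ∀ e {z} → q ^ e ∣ m * z → q ^ e ∣ z
prime^∣*-cancelˡ q-prime q∤m zero {z} _ = 1∣ z
prime^∣*-cancelˡ {q} {m} q-prime q∤m (suc e) {z} q^[1+e]∣mz
  with euclidsLemma m z q-prime (∣-trans (m∣m*n (q ^ e)) q^[1+e]∣mz)
... | inj₁ q∣m = contradiction q∣m q∤m
... | inj₂ (divides z′ refl) =
  subst (q ^ suc e ∣_) (*-comm q z′) (*-monoʳ-∣ q (prime^∣*-cancelˡ q-prime q∤m e q^e∣mz′))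
  where
  instance _ = prime⇒nonZero q-prime
  q^e∣mz′ : q ^ e ∣ m * z′
  q^e∣mz′ = *-cancelˡ-∣ q (subst (q ^ suc e ∣_) (swap m z′ q) q^[1+e]∣mz)
    where
    swap : ∀ m z q → m * (z * q) ≡ q * (m * z)
    swap = solve-∀

-- Peel off the first prime p: it divides X = X′ p, and every prime power dividing the remaining
-- product still divides X′ (for q = p cancel p from q^(e+1) ∣ X, for q ≠ p use q ∤ p).
product∣-byPrimePowers : ∀ ps → All Prime ps → ∀ {X} →
                         (∀ {q} e → Prime q → q ^ e ∣ product ps → q ^ e ∣ X) → product ps ∣ X
product∣-byPrimePowers [] [] {X} _ = 1∣ X
product∣-byPrimePowers (p ∷ ps) (p-prime ∷ ps-prime) {X} powers∣X
  with subst (_∣ X) (*-identityʳ p) (powers∣X 1 p-prime (*-monoʳ-∣ p (1∣ product ps)))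
... | divides X′ refl = subst (p * product ps ∣_) (*-comm p X′)
                          (*-monoʳ-∣ p (product∣-byPrimePowers ps ps-prime powers∣X′))
  where
  instance _ = prime⇒nonZero p-prime
  powers∣X′ : ∀ {q} e → Prime q → q ^ e ∣ product ps → q ^ e ∣ X′
  powers∣X′ {q} e q-prime q^e∣ps with q ∣? p
  ... | no q∤p = prime^∣*-cancelˡ q-prime q∤p e
                   (subst (q ^ e ∣_) (*-comm X′ p) (powers∣X e q-prime (∣n⇒∣m*n p q^e∣ps)))
  ... | yes q∣p with prime∣prime⇒≡ q-prime p-prime q∣p
  ...   | refl = *-cancelˡ-∣ p (subst (p ^ suc e ∣_) (*-comm X′ p)
                                  (powers∣X (suc e) q-prime (*-monoʳ-∣ p q^e∣ps)))

∣-byPrimePowers : ∀ {Y X} .{{_ : NonZero Y}} →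
                  (∀ {q} e → Prime q → q ^ e ∣ Y → q ^ e ∣ X) → Y ∣ X
∣-byPrimePowers {Y} {X} powers∣X =
  subst (_∣ X) (sym Y≡product) (product∣-byPrimePowers factors factorsPrime
    (λ e q-prime q^e∣ps → powers∣X e q-prime (subst (_ ∣_) (sym Y≡product) q^e∣ps)))
  where
  open PrimeFactorisation (factorise Y) renaming (isFactorisation to Y≡product)

1<prime : ∀ {p} → Prime p → 1 < p
1<prime {p} p-prime = nonTrivial⇒n>1 p {{prime⇒nonTrivial p-prime}}

module _ {p} (p-prime : Prime p) where

  private instance
    p≢0 : NonZero p
    p≢0 = prime⇒nonZero p-prime

  p^a∣p^b*r⇒a≤b : ∀ a b {r} → ¬ p ∣ r → p ^ a ∣ p ^ b * r → a ≤ b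
  p^a∣p^b*r⇒a≤b zero    b       p∤r _ = z≤n
  p^a∣p^b*r⇒a≤b (suc a) zero    {r} p∤r p^[1+a]∣r =
    contradiction (∣-trans (m∣m*n (p ^ a)) (subst (p ^ suc a ∣_) (*-identityˡ r) p^[1+a]∣r)) p∤r
  p^a∣p^b*r⇒a≤b (suc a) (suc b) {r} p∤r p^[1+a]∣p^[1+b]r =
    s≤s (p^a∣p^b*r⇒a≤b a b p∤r (*-cancelˡ-∣ p (subst (p ^ suc a ∣_) (*-assoc p (p ^ b) r) p^[1+a]∣p^[1+b]r)))

  factorOut : ∀ x .{{_ : NonZero x}} → ∃[ v ] ∃[ s ] x ≡ p ^ v * s × ¬ p ∣ s
  factorOut x = go x x ≤-refl
    where
    go : ∀ fuel x → x ≤ fuel → .{{_ : NonZero x}} → ∃[ v ] ∃[ s ] x ≡ p ^ v * s × ¬ p ∣ s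
    go zero    (suc x) ()
    go (suc fuel) x x≤fuel with p ∣? x
    ... | no p∤x = 0 , x , sym (*-identityˡ x) , p∤x
    ... | yes (divides y refl) with go fuel y y≤fuel
      where
      instance _ = m*n≢0⇒m≢0 y {p}
      y≤fuel : y ≤ fuel
      y≤fuel = ≤-pred (≤-trans (m<m*n y p (1<prime p-prime)) x≤fuel)
    ...   | v , s , refl , p∤s = suc v , s , reassoc (p ^ v) s p , p∤s
      where
      reassoc : ∀ a s p → a * s * p ≡ p * a * s
      reassoc = solve-∀

  module _ (K : ℕ) where

    ν : ℕ → ℕ
    ν x = sumTo K (λ i → indicator (p ^ i ∣? x))

    legendre : ℕ → ℕ
    legendre n = sumTo K (λ i → multiples (p ^ i) n)

    x≡p^ν*s : ∀ x .{{_ : NonZero x}} → x < p ^ suc K → ∃[ s ] x ≡ p ^ ν x * s × ¬ p ∣ s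
    x≡p^ν*s _ x<p^[1+K] with factorOut _
    ... | v , s , refl , p∤s = s , cong (λ w → p ^ w * s) (sym ν≡v) , p∤s
      where
      instance _ = m*n≢0⇒n≢0 (p ^ v)
      v≤K : v ≤ K
      v≤K = ≤-pred (^-cancelʳ-< (1<prime p-prime) (≤-<-trans (m≤m*n (p ^ v) s) x<p^[1+K]))
      below : ∀ i → i ≤ v → indicator (p ^ i ∣? p ^ v * s) ≡ 1
      below i i≤v with p ^ i ∣? p ^ v * s
      ... | yes _ = refl
      ... | no p^i∤x = contradiction (∣m⇒∣m*n s (^-monoʳ-∣ p i≤v)) p^i∤x
      above : ∀ i → v < i → indicator (p ^ i ∣? p ^ v * s) ≡ 0
      above i v<i with p ^ i ∣? p ^ v * s
      ... | yes p^i∣x = contradiction (p^a∣p^b*r⇒a≤b i v p∤s p^i∣x) (<⇒≱ v<i)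
      ... | no _ = refl
      ν≡v : ν (p ^ v * s) ≡ v
      ν≡v = trans (sumTo-threshold K v below above) (m≥n⇒m⊓n≡n v≤K)

    n!≡p^legendre*r : ∀ n → n < p ^ suc K → ∃[ r ] n ! ≡ p ^ legendre n * r × ¬ p ∣ r
    n!≡p^legendre*r zero _ = 1 , cong (λ w → p ^ w * 1) (sym legendre[0]≡0) , p∤1
      where
      legendre[0]≡0 : legendre 0 ≡ 0
      legendre[0]≡0 = trans (sumTo-const K 0) (*-zeroʳ K)
      p∤1 : ¬ p ∣ 1
      p∤1 p∣1 = <⇒≢ (1<prime p-prime) (sym (∣1⇒≡1 p∣1))
    n!≡p^legendre*r (suc n) 1+n<p^[1+K]
      with x≡p^ν*s (suc n) 1+n<p^[1+K] | n!≡p^legendre*r n (<-trans (n<1+n n) 1+n<p^[1+K])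
    ... | s , 1+n≡p^ν*s , p∤s | r , n!≡p^l*r , p∤r = s * r , [1+n]!≡ , p∤sr
      where
      p∤sr : ¬ p ∣ s * r
      p∤sr = [ p∤s , p∤r ] ∘ euclidsLemma s r p-prime
      [1+n]!≡ : suc n ! ≡ p ^ legendre (suc n) * (s * r)
      [1+n]!≡ = begin
        suc n * n !                                 ≡⟨ cong₂ _*_ 1+n≡p^ν*s n!≡p^l*r ⟩
        (p ^ ν (suc n) * s) * (p ^ legendre n * r)  ≡⟨ interchange (p ^ ν (suc n)) s (p ^ legendre n) r ⟩
        (p ^ ν (suc n) * p ^ legendre n) * (s * r)  ≡⟨ cong (_* (s * r)) (^-distribˡ-+-* p (ν (suc n)) (legendre n)) ⟨
        p ^ (ν (suc n) + legendre n) * (s * r)      ≡⟨ cong (λ w → p ^ w * (s * r)) (sumTo-distrib-+ K _ _) ⟨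
        p ^ legendre (suc n) * (s * r)              ∎
        where
        open ≡-Reasoning
        interchange : ∀ a s b r → (a * s) * (b * r) ≡ (a * b) * (s * r)
        interchange = solve-∀

    p^legendre∣n! : ∀ n → n < p ^ suc K → p ^ legendre n ∣ n !
    p^legendre∣n! n n<p^[1+K] with n!≡p^legendre*r n n<p^[1+K]
    ... | r , n!≡p^l*r , _ = subst (p ^ legendre n ∣_) (sym n!≡p^l*r) (m∣m*n r)

    p^e∣n!⇒e≤legendre : ∀ n e → n < p ^ suc K → p ^ e ∣ n ! → e ≤ legendre n
    p^e∣n!⇒e≤legendre n e n<p^[1+K] p^e∣n! with n!≡p^legendre*r n n<p^[1+K]
    ... | r , n!≡p^l*r , p∤r = p^a∣p^b*r⇒a≤b e (legendre n) p∤r (subst (p ^ e ∣_) n!≡p^l*r p^e∣n!)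

    legendre-+ : ∀ m n → legendre (m + n) ≤ legendre m + legendre n + K
    legendre-+ m n = begin
      legendre (m + n)                                                  ≤⟨ sumTo-mono-≤ K (λ i → multiples-+ (p ^ i) {{m^n≢0 p i}} m n) ⟩
      sumTo K (λ i → multiples (p ^ i) m + multiples (p ^ i) n + 1)     ≡⟨ sumTo-distrib-+ K _ _ ⟩
      sumTo K (λ i → multiples (p ^ i) m + multiples (p ^ i) n) + sumTo K (λ _ → 1) ≡⟨ cong₂ _+_ (sumTo-distrib-+ K _ _) (trans (sumTo-const K 1) (*-identityʳ K)) ⟩
      legendre m + legendre n + K                                       ∎
      where open ≤-Reasoning

module _ {L M E d : ℕ} .{{_ : NonZero M}} (M+M≤L*L : M + M ≤ L * L) (M+M≤2^E : M + M ≤ 2 ^ E)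
         (primes∣d : ∀ q → L < q → q ≤ M + M → Prime q → q ∣ d) where

  -- For q ≤ L, q^K divides (L!)^K and K ≤ E; for q > L, q² > L² ≥ M + M forces K ≤ 1,
  -- and then q ∈ (L, M + M] divides d.
  prime^K∣L!^E*d : ∀ {q} K → Prime q → q ^ K ≤ M + M → q ^ K ∣ (L !) ^ E * d
  prime^K∣L!^E*d {q} K q-prime q^K≤M+M with q ≤? L
  ... | yes q≤L = ∣m⇒∣m*n d (∣-trans (^-monoˡ-∣ K q∣L!) (^-monoʳ-∣ (L !) K≤E))
    where
    instance _ = prime⇒nonZero q-prime
    q∣L! : q ∣ L !
    q∣L! = ∣-trans (n∣n! q) (m≤n⇒m!∣n! q≤L)
    K≤E : K ≤ E
    K≤E = ^-cancelʳ-≤ (n<1+n 1)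
            (≤-trans (^-monoˡ-≤ K (1<prime q-prime)) (≤-trans q^K≤M+M M+M≤2^E))
  ... | no q≰L = large K q^K≤M+M
    where
    L<q = ≰⇒> q≰L
    large : ∀ K → q ^ K ≤ M + M → q ^ K ∣ (L !) ^ E * d
    large zero          _       = 1∣ _
    large (suc zero)    q^1≤M+M = ∣n⇒∣m*n ((L !) ^ E) (subst (_∣ d) (sym (*-identityʳ q))
      (primes∣d q L<q (subst (_≤ M + M) (*-identityʳ q) q^1≤M+M) q-prime))
    large (suc (suc K)) q^K≤M+M = contradiction q^K≤M+M (<⇒≱ (begin-strict
      M + M            ≤⟨ M+M≤L*L ⟩
      L * L            <⟨ *-mono-< L<q L<q ⟩
      q * q            ≡⟨ cong (q *_) (*-identityʳ q) ⟨
      q ^ 2            ≤⟨ ^-monoʳ-≤ q {{prime⇒nonZero q-prime}} (m≤m+n 2 K) ⟩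
      q ^ suc (suc K)  ∎))
      where open ≤-Reasoning

  [M+M]!∣M!*M!*L!^E*d : (M + M) ! ∣ (M ! * M !) * ((L !) ^ E * d)
  [M+M]!∣M!*M!*L!^E*d = ∣-byPrimePowers {{(M + M) !≢0}} prime^e∣
    where
    prime^e∣ : ∀ {q} e → Prime q → q ^ e ∣ (M + M) ! → q ^ e ∣ (M ! * M !) * ((L !) ^ E * d)
    prime^e∣ {q} e q-prime q^e∣[M+M]!
      with ∃-⌊log⌋ (1<prime q-prime) (M + M) (≤-trans (>-nonZero⁻¹ M) (m≤m+n M M))
    ... | K , q^K≤M+M , M+M<q^[1+K] = ∣-trans (^-monoʳ-∣ q e≤l+l+K)
      (subst (_∣ _) (sym q^[l+l+K]≡) (*-pres-∣ (*-pres-∣ q^l∣M! q^l∣M!) (prime^K∣L!^E*d K q-prime q^K≤M+M)))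
      where
      l = legendre q-prime K M
      e≤l+l+K : e ≤ l + l + K
      e≤l+l+K = ≤-trans (p^e∣n!⇒e≤legendre q-prime K (M + M) e M+M<q^[1+K] q^e∣[M+M]!)
                        (legendre-+ q-prime K M M)
      q^l∣M! : q ^ l ∣ M !
      q^l∣M! = p^legendre∣n! q-prime K M (≤-<-trans (m≤m+n M M) M+M<q^[1+K])
      q^[l+l+K]≡ : q ^ (l + l + K) ≡ q ^ l * q ^ l * q ^ K
      q^[l+l+K]≡ = trans (^-distribˡ-+-* q (l + l) K) (cong (_* q ^ K) (^-distribˡ-+-* q l l))

n!≤n^n : ∀ n → n ! ≤ n ^ n
n!≤n^n zero    = ≤-refl
n!≤n^n (suc n) = *-monoʳ-≤ (suc n) (≤-trans (n!≤n^n n) (^-monoˡ-≤ n (n≤1+n n)))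

2^n*n!*n!≤[n+n]! : ∀ n → 2 ^ n * (n ! * n !) ≤ (n + n) !
2^n*n!*n!≤[n+n]! zero    = ≤-refl
2^n*n!*n!≤[n+n]! (suc n) = begin
  2 ^ suc n * (suc n ! * suc n !)                    ≡⟨ regroup (2 ^ n) n (n !) ⟩
  suc (suc (n + n)) * suc n * (2 ^ n * (n ! * n !))  ≤⟨ *-mono-≤ (*-monoʳ-≤ (suc (suc (n + n))) (s≤s (m≤m+n n n))) (2^n*n!*n!≤[n+n]! n) ⟩
  suc (suc (n + n)) * suc (n + n) * (n + n) !        ≡⟨ *-assoc (suc (suc (n + n))) (suc (n + n)) ((n + n) !) ⟩
  suc (suc (n + n)) !                                ≡⟨ cong (λ m → suc m !) (+-suc n n) ⟨
  (suc n + suc n) !                                  ∎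
  where
  open ≤-Reasoning
  regroup : ∀ a n f → 2 * a * ((suc n * f) * (suc n * f)) ≡ suc (suc (n + n)) * suc n * (a * (f * f))
  regroup = solve-∀

L!^E*d<2^M : ∀ {L d} a E {M} → L < 2 ^ a → d < 2 ^ suc L → (a * E + 1) * 2 ^ a ≤ M →
             (L !) ^ E * d < 2 ^ M
L!^E*d<2^M {L} {d} a E {M} L<2^a d<2^[1+L] [aE+1]2^a≤M = begin-strict
  (L !) ^ E * d              <⟨ *-monoʳ-< ((L !) ^ E) {{m^n≢0 (L !) E {{L !≢0}}}} d<2^B ⟩
  (L !) ^ E * 2 ^ B          ≤⟨ *-monoˡ-≤ (2 ^ B) (^-monoˡ-≤ E L!≤B^B) ⟩
  (B ^ B) ^ E * 2 ^ B        ≡⟨ cong (_* 2 ^ B) (trans (^-*-assoc B B E) (^-*-assoc 2 a (B * E))) ⟩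
  2 ^ (a * (B * E)) * 2 ^ B  ≡⟨ ^-distribˡ-+-* 2 (a * (B * E)) B ⟨
  2 ^ (a * (B * E) + B)      ≡⟨ cong (2 ^_) (factor a B E) ⟩
  2 ^ ((a * E + 1) * B)      ≤⟨ ^-monoʳ-≤ 2 [aE+1]2^a≤M ⟩
  2 ^ M                      ∎
  where
  open ≤-Reasoning
  B = 2 ^ a
  d<2^B : d < 2 ^ B
  d<2^B = <-≤-trans d<2^[1+L] (^-monoʳ-≤ 2 L<2^a)
  L!≤B^B : L ! ≤ B ^ B
  L!≤B^B = ≤-trans (n!≤n^n L) (≤-trans (^-monoˡ-≤ L (<⇒≤ L<2^a)) (^-monoʳ-≤ B {{m^n≢0 2 a}} (<⇒≤ L<2^a)))
  factor : ∀ a B E → a * (B * E) + B ≡ (a * E + 1) * B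
  factor = solve-∀

quadratic≤2^ : ∀ i → 8 ≤ i → (3 + i) * ((2 + i) + (2 + i)) + 1 ≤ 2 ^ i
quadratic≤2^ i 8≤i = subst (λ j → f j ≤ 2 ^ j) (m+[n∸m]≡n 8≤i) (from8 (i ∸ 8))
  where
  f : ℕ → ℕ
  f i = (3 + i) * ((2 + i) + (2 + i)) + 1
  f[1+i]≤2f[i] : ∀ i → f (suc i) ≤ 2 * f i
  f[1+i]≤2f[i] i = subst (f (suc i) ≤_) (sym (2f≡ i)) (m≤m+n (f (suc i)) _)
    where
    2f≡ : ∀ i → 2 * ((3 + i) * ((2 + i) + (2 + i)) + 1) ≡
                ((4 + i) * ((3 + i) + (3 + i)) + 1) + (2 * i * i + 6 * i + 1)
    2f≡ = solve-∀
  from8 : ∀ t → f (8 + t) ≤ 2 ^ (8 + t)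
  from8 zero    = toWitness {a? = f 8 ≤? 2 ^ 8} _
  from8 (suc t) = ≤-trans (f[1+i]≤2f[i] (8 + t)) (*-monoʳ-≤ 2 (from8 t))

module _ {L d : ℕ} .{{_ : NonZero d}} (d<2^[1+L] : d < 2 ^ suc L) where

  prime∤-above-via-[M+M]! : ∀ a E M .{{_ : NonZero M}} → L < 2 ^ a → (a * E + 1) * 2 ^ a ≤ M →
                    M + M ≤ L * L → M + M ≤ 2 ^ E →
                    ∃[ p ] L < p × p ≤ L * L × Prime p × ¬ p ∣ d
  prime∤-above-via-[M+M]! a E M L<2^a [aE+1]2^a≤M M+M≤L*L M+M≤2^E
    with anyUpTo? (λ q → L <? q ×-dec prime? q ×-dec ¬? (q ∣? d)) (suc (M + M))
  ... | yes (p , p≤M+M , L<p , p-prime , p∤d) = p , L<p , ≤-trans (≤-pred p≤M+M) M+M≤L*L , p-prime , p∤d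
  ... | no ∄p = contradiction (L!^E*d<2^M a E L<2^a d<2^[1+L] [aE+1]2^a≤M) (≤⇒≯ 2^M≤L!^E*d)
    where
    instance
      _ = M !* M !≢0
      _ = m^n≢0 (L !) E {{L !≢0}}
      _ = m*n≢0 ((L !) ^ E) d
      _ = m*n≢0 (M ! * M !) ((L !) ^ E * d)
    primes∣d : ∀ q → L < q → q ≤ M + M → Prime q → q ∣ d
    primes∣d q L<q q≤M+M q-prime = decidable-stable (q ∣? d) λ q∤d → ∄p (q , s≤s q≤M+M , L<q , q-prime , q∤d)
    2^M≤L!^E*d : 2 ^ M ≤ (L !) ^ E * d
    2^M≤L!^E*d = *-cancelʳ-≤ (2 ^ M) ((L !) ^ E * d) (M ! * M !) (begin
      2 ^ M * (M ! * M !)               ≤⟨ 2^n*n!*n!≤[n+n]! M ⟩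
      (M + M) !                          ≤⟨ ∣⇒≤ ([M+M]!∣M!*M!*L!^E*d {E = E} M+M≤L*L M+M≤2^E primes∣d) ⟩
      (M ! * M !) * ((L !) ^ E * d)      ≡⟨ *-comm (M ! * M !) ((L !) ^ E * d) ⟩
      (L !) ^ E * d * (M ! * M !)        ∎)
      where open ≤-Reasoning

  prime∤-above : 2 ^ 10 ≤ L → ∃[ p ] L < p × p ≤ L * L × Prime p × ¬ p ∣ d
  prime∤-above 2^10≤L with ∃-⌊log⌋ (n<1+n 1) L (≤-trans (m^n>0 2 10) 2^10≤L)
  ... | k , 2^k≤L , L<2^[1+k] =
    withExponent k (≤-pred (^-cancelʳ-< (n<1+n 1) (≤-<-trans 2^10≤L L<2^[1+k]))) 2^k≤L L<2^[1+k]
    where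
    -- With k = ⌊log₂ L⌋ ≥ 10 take M = 2^(2k-1), so that M + M = 2^(2k) ≤ L².
    withExponent : ∀ k → 10 ≤ k → 2 ^ k ≤ L → L < 2 ^ suc k → ∃[ p ] L < p × p ≤ L * L × Prime p × ¬ p ∣ d
    withExponent k@(suc (suc i)) (s≤s (s≤s 8≤i)) 2^k≤L L<2^[1+k] =
      prime∤-above-via-[M+M]! (suc k) (k + k) M {{m^n≢0 2 (suc i + k)}} L<2^[1+k] [aE+1]2^a≤M M+M≤L*L (≤-reflexive M+M≡2^[k+k])
      where
      M = 2 ^ (suc i + k)
      M+M≡2^[k+k] : M + M ≡ 2 ^ (k + k)
      M+M≡2^[k+k] = cong (M +_) (sym (+-identityʳ M))
      M+M≤L*L : M + M ≤ L * L
      M+M≤L*L = begin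
        M + M          ≡⟨ M+M≡2^[k+k] ⟩
        2 ^ (k + k)    ≡⟨ ^-distribˡ-+-* 2 k k ⟩
        2 ^ k * 2 ^ k  ≤⟨ *-mono-≤ 2^k≤L 2^k≤L ⟩
        L * L          ∎
        where open ≤-Reasoning
      [aE+1]2^a≤M : (suc k * (k + k) + 1) * 2 ^ suc k ≤ M
      [aE+1]2^a≤M = begin
        (suc k * (k + k) + 1) * 2 ^ suc k  ≤⟨ *-monoˡ-≤ (2 ^ suc k) (quadratic≤2^ i 8≤i) ⟩
        2 ^ i * 2 ^ suc k                  ≡⟨ ^-distribˡ-+-* 2 i (suc k) ⟨
        2 ^ (i + suc k)                    ≡⟨ cong (2 ^_) (+-suc i k) ⟩
        M                                  ∎
        where open ≤-Reasoning

sum-map-if≤length : ∀ {X : Set} (g : X → Bool) xs → sum (map (λ x → if g x then 1 else 0) xs) ≤ length xs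
sum-map-if≤length g []       = z≤n
sum-map-if≤length g (x ∷ xs) with g x
... | true  = s≤s (sum-map-if≤length g xs)
... | false = m≤n⇒m≤1+n (sum-map-if≤length g xs)

length-concatMap-const : ∀ {A B : Set} {f : A → List B} {c} → (∀ x → length (f x) ≡ c) →
                         ∀ xs → length (concatMap f xs) ≡ length xs * c
length-concatMap-const          |f|≡c []       = refl
length-concatMap-const {f = f} |f|≡c (x ∷ xs) = begin
  length (f x ++ concatMap f xs)             ≡⟨ length-++ (f x) ⟩
  length (f x) + length (concatMap f xs)     ≡⟨ cong₂ _+_ (|f|≡c x) (length-concatMap-const |f|≡c xs) ⟩
  _ + length xs * _                          ∎
  where open ≡-Reasoning

length-allMaps : ∀ k m → length (allMaps k m) ≡ m ^ k
length-allMaps zero    m = refl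
length-allMaps (suc k) m = begin
  length (concatMap (λ i → map (i ∷_) (allMaps k m)) (allFin m))  ≡⟨ length-concatMap-const (λ i → length-map (i ∷_) (allMaps k m)) (allFin m) ⟩
  length (allFin m) * length (allMaps k m)                          ≡⟨ cong₂ _*_ (length-tabulate {n = m} id) (length-allMaps k m) ⟩
  m * m ^ k                                                          ∎
  where open ≡-Reasoning

hom≤ : ∀ F G → hom F G ≤ V G ^ V F
hom≤ F G = subst (hom F G ≤_) (length-allMaps (V F) (V G)) (sum-map-if≤length (isHom F G) (allMaps (V F) (V G)))

hom≤n^N : ∀ F G {n N} .{{_ : NonZero n}} → V F ≤ N → V G ≤ n → hom F G ≤ n ^ N
hom≤n^N F G {n} |F|≤N |G|≤n = ≤-trans (hom≤ F G) (≤-trans (^-monoˡ-≤ (V F) |G|≤n) (^-monoʳ-≤ n |F|≤N))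

∣+m-+n∣≡∣m-n∣ : ∀ m n → ℤ.∣ ℤ.+ m ℤ.- ℤ.+ n ∣ ≡ ∣ m - n ∣
∣+m-+n∣≡∣m-n∣ m n rewrite ℤ.m-n≡m⊖n m n with ≤-total m n
... | inj₁ m≤n = trans (ℤ.∣⊖∣-≤ m≤n) (sym (m≤n⇒∣m-n∣≡n∸m m≤n))
... | inj₂ n≤m = begin
  ℤ.∣ m ℤ.⊖ n ∣  ≡⟨ ℤ.∣m⊖n∣≡∣n⊖m∣ m n ⟩
  ℤ.∣ n ℤ.⊖ m ∣  ≡⟨ ℤ.∣⊖∣-≤ n≤m ⟩
  m ∸ n        ≡⟨ m≤n⇒∣m-n∣≡n∸m n≤m ⟨
  ∣ n - m ∣    ≡⟨ ∣-∣-comm n m ⟩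
  ∣ m - n ∣    ∎
  where open ≡-Reasoning

-- Divisibility in ℤ is divisibility of absolute values in ℕ.
¬∣∣m-n∣⇒≢[mod] : ∀ {p m n} → ¬ p ∣ ∣ m - n ∣ → ¬ m ≡ n [mod p ]
¬∣∣m-n∣⇒≢[mod] {p} {m} {n} p∤∣m-n∣ p∣m-n = p∤∣m-n∣ (subst (p ∣_) (∣+m-+n∣≡∣m-n∣ m n) p∣m-n)

m*m≤n*n⇒m≤n : ∀ {m n} → m * m ≤ n * n → m ≤ n
m*m≤n*n⇒m≤n {m} {n} m*m≤n*n with m ≤? n
... | yes m≤n = m≤n
... | no m≰n = contradiction m*m≤n*n (<⇒≱ (*-mono-< (≰⇒> m≰n) (≰⇒> m≰n)))

SqLe-≤ : ∀ {p L N n} → 2 ^ L ≤ n ^ N → p ≤ L * L → SqLe p N n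
SqLe-≤ {p} {L} {N} {n} 2^L≤n^N p≤L*L a b a*a≤p[1+b]² = begin
  2 ^ a                ≤⟨ ^-monoʳ-≤ 2 a≤L[1+b] ⟩
  2 ^ (L * suc b)      ≡⟨ ^-*-assoc 2 L (suc b) ⟨
  (2 ^ L) ^ suc b      ≤⟨ ^-monoˡ-≤ (suc b) 2^L≤n^N ⟩
  (n ^ N) ^ suc b      ≡⟨ ^-*-assoc n N (suc b) ⟩
  n ^ (N * suc b)      ∎
  where
  open ≤-Reasoning
  a≤L[1+b] : a ≤ L * suc b
  a≤L[1+b] = m*m≤n*n⇒m≤n (begin
    a * a                          ≤⟨ a*a≤p[1+b]² ⟩
    p * (suc b * suc b)            ≤⟨ *-monoˡ-≤ (suc b * suc b) p≤L*L ⟩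
    L * L * (suc b * suc b)        ≡⟨ interchange L (suc b) ⟩
    L * suc b * (L * suc b)        ∎)
    where
    interchange : ∀ x y → x * x * (y * y) ≡ x * y * (x * y)
    interchange = solve-∀

1<m^n⇒m≢0 : ∀ {m} n → 1 < m ^ n → NonZero m
1<m^n⇒m≢0 {zero}  zero    (s≤s ())
1<m^n⇒m≢0 {zero}  (suc n) ()
1<m^n⇒m≢0 {suc m} _       _ = _

-- The instances m = 0 and m = 1 of the hypothesis say 1 ≤ N log₂ n and 2^2000 ≤ N log₂ n.
ExpBoundLe⇒1<n^N : ∀ N n → ExpBoundLe N n → 1 < n ^ N
ExpBoundLe⇒1<n^N N n e^2000≤Nlog₂n = subst (λ e → 2 ≤ n ^ e) (*-identityʳ N) (e^2000≤Nlog₂n 0)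

ExpBoundLe⇒2^10≤L : ∀ N n L → ExpBoundLe N n → n ^ N < 2 ^ suc L → 2 ^ 10 ≤ L
ExpBoundLe⇒2^10≤L N n L e^2000≤Nlog₂n n^N<2^[1+L] =
  ≤-trans (toWitness {a? = 2 ^ 10 ≤? eNum 1 ^ 2000} _)
          (≤-pred (^-cancelʳ-< {2} {eNum 1 ^ 2000} (n<1+n 1) (≤-<-trans 2^[2^2000]≤n^N n^N<2^[1+L])))
  where
  2^[2^2000]≤n^N : 2 ^ (eNum 1 ^ 2000) ≤ n ^ N
  2^[2^2000]≤n^N = subst (λ e → 2 ^ (eNum 1 ^ 2000) ≤ n ^ e) (*-identityʳ N) (e^2000≤Nlog₂n 1)

-- Implicit arguments are passed explicitly: inferring them would make Agda unfold hom.
lemma27 : (N n : ℕ) → ExpBoundLe N n → (𝓕 : GraphClass) → (G H : Graph) →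
    V G ≤ n → V H ≤ n → NotEquivLe 𝓕 N G H →
    Σ ℕ λ p → Prime p × NLogLt N n p × SqLe p N n × NotEquivModLe p 𝓕 N G H
lemma27 N n e^2000≤Nlog₂n 𝓕 G H |G|≤n |H|≤n (F , F∈𝓕 , |F|≤N , homs≢) =
  let L , 2^L≤n^N , n^N<2^[1+L] = ∃-⌊log⌋ (n<1+n 1) (n ^ N) (<⇒≤ 1<n^N)
      p , L<p , p≤L*L , p-prime , p∤d = prime∤-above {L} {d} {{d≢0}} (≤-<-trans d≤n^N n^N<2^[1+L])
                                          (ExpBoundLe⇒2^10≤L N n L e^2000≤Nlog₂n n^N<2^[1+L])
  in p , p-prime , <-≤-trans n^N<2^[1+L] (^-monoʳ-≤ 2 L<p) , SqLe-≤ {p} {L} {N} {n} 2^L≤n^N p≤L*L ,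
     F , F∈𝓕 , |F|≤N , ¬∣∣m-n∣⇒≢[mod] {p} {hom F G} {hom F H} p∤d
  where
  1<n^N : 1 < n ^ N
  1<n^N = ExpBoundLe⇒1<n^N N n e^2000≤Nlog₂n
  instance _ = 1<m^n⇒m≢0 N 1<n^N
  d = ∣ hom F G - hom F H ∣
  d≢0 : NonZero d
  d≢0 = ≢-nonZero (homs≢ ∘ ∣m-n∣≡0⇒m≡n)
  d≤n^N : d ≤ n ^ N
  d≤n^N = ≤-trans (∣m-n∣≤m⊔n (hom F G) (hom F H)) (⊔-lub (hom≤n^N F G |F|≤N |G|≤n) (hom≤n^N F H |F|≤N |H|≤n))
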